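{- A $\mathsf{BST}$-conjunction $\Phi$ is satisfiable if and only if there is a map $\mathfrak{F}:V\to\mathcal{P}(\mathcal{P}^+(V))$, where $V=\mathrm{Vars}(\Phi)$ and $\mathcal{P}^+(V)=\mathcal{P}(V)\setminus\{\emptyset\}$, such that (a) $\mathfrak{F}(x)=\mathfrak{F}(y)\star\mathfrak{F}(z)$ for each conjunct $x=y\star z$ of $\Phi$ with $\star\in\{\cup,\setminus\}$, and (b) $\mathfrak{F}(x)\neq\mathfrak{F}(y)$ for each conjunct $x\neq y$ of $\Phi$.
   Context: A $\mathsf{BST}$-conjunction is a finite conjunction of literals of the forms $x=y\cup z$, $x=y\setminus z$, $x\neq y$, with $x,y,z$ set variables; it is satisfiable if some assignment of (well-founded) sets to its variables makes all literals true. $\mathcal{P}(\cdot)$ denotes power set. -}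

module Defs where

open import Level using (0ℓ)
open import Data.Bool using (Bool; true; false; _∨_; _∧_; not)
open import Data.Fin using (Fin)
open import Data.Fin.Subset using (Subset; Nonempty)
open import Data.List using (List)
open import Data.List.Relation.Unary.All using (All)
open import Data.List.Relation.Unary.Any using (Any)
open import Data.Nat using (ℕ)
open import Data.Product using (Σ; ∃; _×_; proj₁)
open import Data.Sum using (_⊎_; inj₁; inj₂)
open import Relation.Nullary using (¬_)
open import Relation.Binary.PropositionalEquality using (_≡_)

-- Well-founded (iterative) sets à la Aczel, with extensional equality.

data 𝕍 : Set₁ where
  sup : (A : Set) → (A → 𝕍) → 𝕍

_≐_ : 𝕍 → 𝕍 → Set
sup A f ≐ sup B g = (∀ a → ∃ λ b → f a ≐ g b) × (∀ b → ∃ λ a → f a ≐ g b)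

_∈𝕍_ : 𝕍 → 𝕍 → Set
x ∈𝕍 sup A f = ∃ λ a → x ≐ f a

_∪𝕍_ : 𝕍 → 𝕍 → 𝕍
sup A f ∪𝕍 sup B g = sup (A ⊎ B) h
  where
  h : A ⊎ B → 𝕍
  h (inj₁ a) = f a
  h (inj₂ b) = g b

_∖𝕍_ : 𝕍 → 𝕍 → 𝕍
sup A f ∖𝕍 y = sup (Σ A λ a → ¬ (f a ∈𝕍 y)) (λ p → f (proj₁ p))

data Literal (n : ℕ) : Set where
  _≔_∪_ : Fin n → Fin n → Fin n → Literal n
  _≔_∖_ : Fin n → Fin n → Fin n → Literal n
  _≠_   : Fin n → Fin n → Literal n

Conj : ℕ → Set
Conj n = List (Literal n)

OccursL : ∀ {n} → Fin n → Literal n → Set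
OccursL v (x ≔ y ∪ z) = v ≡ x ⊎ v ≡ y ⊎ v ≡ z
OccursL v (x ≔ y ∖ z) = v ≡ x ⊎ v ≡ y ⊎ v ≡ z
OccursL v (x ≠ y)     = v ≡ x ⊎ v ≡ y

Occurs : ∀ {n} → Fin n → Conj n → Set
Occurs v Φ = Any (OccursL v) Φ

SatL : ∀ {n} → (Fin n → 𝕍) → Literal n → Set
SatL M (x ≔ y ∪ z) = M x ≐ (M y ∪𝕍 M z)
SatL M (x ≔ y ∖ z) = M x ≐ (M y ∖𝕍 M z)
SatL M (x ≠ y)     = ¬ (M x ≐ M y)

Satisfiable : ∀ {n} → Conj n → Set₁
Satisfiable {n} Φ = Σ (Fin n → 𝕍) λ M → All (SatL M) Φ

-- P(P⁺(V)) for V = Fin n: a subset of Subset n (given by its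
-- characteristic function) containing only nonempty subsets of V.

PPplus : ℕ → Set
PPplus n = Σ (Subset n → Bool) λ S → ∀ σ → S σ ≡ true → Nonempty σ

_∪ᴾ_ : ∀ {n} → (Subset n → Bool) → (Subset n → Bool) → (Subset n → Bool)
(S ∪ᴾ T) σ = S σ ∨ T σ

_∖ᴾ_ : ∀ {n} → (Subset n → Bool) → (Subset n → Bool) → (Subset n → Bool)
(S ∖ᴾ T) σ = S σ ∧ not (T σ)

_≈ᴾ_ : ∀ {n} → (Subset n → Bool) → (Subset n → Bool) → Set
S ≈ᴾ T = ∀ σ → S σ ≡ T σ

GoodL : ∀ {n} → (Fin n → PPplus n) → Literal n → Set
GoodL 𝔉 (x ≔ y ∪ z) = proj₁ (𝔉 x) ≈ᴾ (proj₁ (𝔉 y) ∪ᴾ proj₁ (𝔉 z))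
GoodL 𝔉 (x ≔ y ∖ z) = proj₁ (𝔉 x) ≈ᴾ (proj₁ (𝔉 y) ∖ᴾ proj₁ (𝔉 z))
GoodL 𝔉 (x ≠ y)     = ¬ (proj₁ (𝔉 x) ≈ᴾ proj₁ (𝔉 y))

{-# OPTIONS --safe #-}
module Submission where

-- Forward: given a model M, send x to the set of Venn regions σ ⊆ V that contain x and are
-- inhabited, i.e. σ = {i | u ∈ M i} for some element u of some M i. Every such u obeys the
-- Boolean law of each literal (u ∈ M x ⇔ u ∈ M y ∨ u ∈ M z, …), and this law transfers to
-- the inhabited regions. Backward: encode each σ ⊆ V injectively as a set ⌜σ⌝ and interpret
-- x as {⌜σ⌝ | σ ∈ 𝔉(x)}; images under an injective map commute with ∪ and ∖ and reflect
-- equality.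

open import Defs
open import Level using (0ℓ)
open import Axiom.ExcludedMiddle using (ExcludedMiddle)
open import Data.Bool using (Bool; true; false; T; _∨_; _∧_; not)
open import Data.Bool.Properties using (T-∨; T-∧; T-not-≡; ∧-conicalʳ)
open import Data.Empty using (⊥)
open import Data.Fin using (Fin; toℕ)
open import Data.Fin.Properties using (toℕ-injective)
open import Data.Fin.Subset using (Subset; Nonempty)
open import Data.List.Relation.Unary.All as All using (All)
open import Data.Nat using (ℕ; zero; suc)
open import Data.Product using (Σ; _×_; _,_; proj₁; proj₂)
open import Data.Sum as Sum using (_⊎_; inj₁; inj₂)
open import Data.Unit using (⊤)
open import Data.Vec using (lookup; tabulate)
open import Data.Vec.Properties using (lookup⇒[]=; lookup∘tabulate; tabulate∘lookup; tabulate-cong)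
open import Function using (_∘_)
open import Function.Bundles using (_⇔_; mk⇔; Equivalence)
open import Function.Construct.Composition using (_⇔-∘_)
open import Relation.Nullary using (¬_; Dec; yes; no; does)
open import Relation.Nullary.Decidable using (does-⇔; dec-true; T?; _⊎-dec_; _×-dec_; ¬?)
open import Relation.Binary.PropositionalEquality
  using (_≡_; _≗_; refl; sym; cong; cong₂; subst; module ≡-Reasoning)

open Equivalence using (to; from)

≐-refl : ∀ u → u ≐ u
≐-refl (sup A f) = (λ a → a , ≐-refl (f a)) , (λ a → a , ≐-refl (f a))

≐-sym : ∀ {u v} → u ≐ v → v ≐ u
≐-sym {sup A f} {sup B g} (p , q) =
  (λ b → proj₁ (q b) , ≐-sym (proj₂ (q b))) ,
  (λ a → proj₁ (p a) , ≐-sym (proj₂ (p a)))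

≐-trans : ∀ {u v w} → u ≐ v → v ≐ w → u ≐ w
≐-trans {sup A f} {sup B g} {sup C h} (p , q) (r , s) =
  (λ a → proj₁ (r (proj₁ (p a))) , ≐-trans (proj₂ (p a)) (proj₂ (r (proj₁ (p a))))) ,
  (λ c → proj₁ (q (proj₁ (s c))) , ≐-trans (proj₂ (q (proj₁ (s c)))) (proj₂ (s c)))

∈-respˡ : ∀ {u v w} → u ≐ v → u ∈𝕍 w → v ∈𝕍 w
∈-respˡ {w = sup A f} u≐v (a , u≐fa) = a , ≐-trans (≐-sym u≐v) u≐fa

∈-respʳ : ∀ {u v w} → v ≐ w → u ∈𝕍 v → u ∈𝕍 w
∈-respʳ {v = sup A f} {sup B g} (p , _) (a , u≐fa) = proj₁ (p a) , ≐-trans u≐fa (proj₂ (p a))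

∈-cong : ∀ {u v w} → v ≐ w → u ∈𝕍 v ⇔ u ∈𝕍 w
∈-cong v≐w = mk⇔ (∈-respʳ v≐w) (∈-respʳ (≐-sym v≐w))

≐-ext : ∀ {v w} → (∀ u → u ∈𝕍 v → u ∈𝕍 w) → (∀ u → u ∈𝕍 w → u ∈𝕍 v) → v ≐ w
≐-ext {sup A f} {sup B g} v⊆w w⊆v =
  (λ a → v⊆w (f a) (a , ≐-refl (f a))) ,
  (λ b → let (a , gb≐fa) = w⊆v (g b) (b , ≐-refl (g b)) in a , ≐-sym gb≐fa)

∈-∪ : ∀ {u v w} → u ∈𝕍 (v ∪𝕍 w) ⇔ (u ∈𝕍 v ⊎ u ∈𝕍 w)
∈-∪ {v = sup A f} {sup B g} = mk⇔
  (λ { (inj₁ a , r) → inj₁ (a , r) ; (inj₂ b , r) → inj₂ (b , r) })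
  (λ { (inj₁ (a , r)) → inj₁ a , r ; (inj₂ (b , r)) → inj₂ b , r })

∈-∖ : ∀ {u v w} → u ∈𝕍 (v ∖𝕍 w) ⇔ (u ∈𝕍 v × ¬ u ∈𝕍 w)
∈-∖ {v = sup A f} {w} = mk⇔
  (λ ((a , fa∉w) , u≐fa) → (a , u≐fa) , fa∉w ∘ ∈-respˡ u≐fa)
  (λ ((a , u≐fa) , u∉w) → (a , u∉w ∘ ∈-respˡ (≐-sym u≐fa)) , u≐fa)

index : 𝕍 → Set
index (sup A f) = A

elem : (v : 𝕍) → index v → 𝕍
elem (sup A f) = f

elem-∈ : ∀ v a → elem v a ∈𝕍 v
elem-∈ (sup A f) a = a , ≐-refl (f a)

∈-index : ∀ {u v} → u ∈𝕍 v → Σ (index v) λ a → u ≐ elem v a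
∈-index {v = sup A f} u∈v = u∈v

image : {A : Set} → (A → 𝕍) → (A → Bool) → 𝕍
image {A} e P = sup (Σ A (T ∘ P)) (e ∘ proj₁)

T-∈-image : ∀ {A} (e : A → 𝕍) {P a} → T (P a) → e a ∈𝕍 image e P
T-∈-image e {a = a} Pa = (a , Pa) , ≐-refl (e a)

image-cong : ∀ {A} (e : A → 𝕍) {P Q} → P ≗ Q → image e P ≐ image e Q
image-cong e P≗Q =
  (λ (a , Pa) → (a , subst T (P≗Q a) Pa) , ≐-refl (e a)) ,
  (λ (a , Qa) → (a , subst T (sym (P≗Q a)) Qa) , ≐-refl (e a))

image-∪ : ∀ {A} (e : A → 𝕍) {P Q} → image e (λ a → P a ∨ Q a) ≐ (image e P ∪𝕍 image e Q)
image-∪ e {P} {Q} = ≐-ext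
  (λ u ((a , PQa) , u≐ea) → from ∈-∪
    (Sum.map (λ Pa → (a , Pa) , u≐ea) (λ Qa → (a , Qa) , u≐ea) (to (T-∨ {P a}) PQa)))
  (λ u → Sum.[ (λ ((a , Pa) , u≐ea) → (a , from T-∨ (inj₁ Pa)) , u≐ea)
             , (λ ((a , Qa) , u≐ea) → (a , from (T-∨ {P a}) (inj₂ Qa)) , u≐ea) ]′ ∘ to ∈-∪)

module InjectiveImage {A : Set} {e : A → 𝕍} (e-injective : ∀ {a b} → e a ≐ e b → a ≡ b) where

  ∈-image-T : ∀ {P a} → e a ∈𝕍 image e P → T (P a)
  ∈-image-T {P} ((b , Pb) , ea≐eb) = subst (T ∘ P) (sym (e-injective ea≐eb)) Pb

  image-∖ : ∀ {P Q} → image e (λ a → P a ∧ not (Q a)) ≐ (image e P ∖𝕍 image e Q)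
  image-∖ {P} {Q} = ≐-ext
    (λ u ((a , Pa∧¬Qa) , u≐ea) → let (Pa , ¬Qa) = to (T-∧ {P a}) Pa∧¬Qa in from ∈-∖
      (((a , Pa) , u≐ea) , λ u∈Q → subst T (to T-not-≡ ¬Qa) (∈-image-T (∈-respˡ u≐ea u∈Q))))
    (λ u u∈P∖Q → let (((a , Pa) , u≐ea) , u∉Q) = to (∈-∖ {u} {image e P}) u∈P∖Q in
      (a , from T-∧ (Pa , ¬T⇒T-not (Q a) (u∉Q ∘ ∈-respˡ (≐-sym u≐ea) ∘ T-∈-image e))) , u≐ea)
    where
    ¬T⇒T-not : ∀ b → ¬ T b → T (not b)
    ¬T⇒T-not false _ = _
    ¬T⇒T-not true ¬Tb = ¬Tb _

  image-injective : ∀ {P Q} → image e P ≐ image e Q → P ≗ Q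
  image-injective {P} {Q} eq a = does-⇔ P⇔Q (T? (P a)) (T? (Q a))
    where
    P⇔Q : T (P a) ⇔ T (Q a)
    P⇔Q = mk⇔ (∈-image-T ∘ ∈-respʳ eq ∘ T-∈-image e)
               (∈-image-T ∘ ∈-respʳ (≐-sym eq) ∘ T-∈-image e)

numeral : ℕ → 𝕍
numeral zero = sup ⊥ λ ()
numeral (suc k) = sup ⊤ λ _ → numeral k

numeral-injective : ∀ {j k} → numeral j ≐ numeral k → j ≡ k
numeral-injective {zero} {zero} _ = refl
numeral-injective {zero} {suc k} (_ , k⊆∅) with k⊆∅ _
... | ()
numeral-injective {suc j} {zero} (j⊆∅ , _) with j⊆∅ _
... | ()
numeral-injective {suc j} {suc k} (j⊆k , _) = cong suc (numeral-injective (proj₂ (j⊆k _)))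

⌜_⌝ : ∀ {n} → Subset n → 𝕍
⌜ σ ⌝ = image (numeral ∘ toℕ) (lookup σ)

⌜⌝-injective : ∀ {n} {σ τ : Subset n} → ⌜ σ ⌝ ≐ ⌜ τ ⌝ → σ ≡ τ
⌜⌝-injective {σ = σ} {τ} ⌜σ⌝≐⌜τ⌝ = begin
  σ                   ≡⟨ tabulate∘lookup σ ⟨
  tabulate (lookup σ) ≡⟨ tabulate-cong (image-injective ⌜σ⌝≐⌜τ⌝) ⟩
  tabulate (lookup τ) ≡⟨ tabulate∘lookup τ ⟩
  τ                   ∎
  where
  open ≡-Reasoning
  open InjectiveImage (toℕ-injective ∘ numeral-injective)

model : ∀ {n} → (Fin n → PPplus n) → Fin n → 𝕍
model 𝔉 x = image ⌜_⌝ (proj₁ (𝔉 x))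

model-sat : ∀ {n} {𝔉 : Fin n → PPplus n} {L} → GoodL 𝔉 L → SatL (model 𝔉) L
model-sat {L = x ≔ y ∪ z} good = ≐-trans (image-cong ⌜_⌝ good) (image-∪ ⌜_⌝)
model-sat {L = x ≔ y ∖ z} good = ≐-trans (image-cong ⌜_⌝ good) image-∖
  where open InjectiveImage ⌜⌝-injective
model-sat {L = x ≠ y} good = good ∘ image-injective
  where open InjectiveImage ⌜⌝-injective

module VennRegions (em : ExcludedMiddle 0ℓ) {n} (M : Fin n → 𝕍) where

  _∈?_ : ∀ u i → Dec (u ∈𝕍 M i)
  u ∈? i = em

  ∈?-sound : ∀ u i → does (u ∈? i) ≡ true → u ∈𝕍 M i
  ∈?-sound u i _  with u ∈? i
  ∈?-sound u i _  | yes u∈Mi = u∈Mi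
  ∈?-sound u i () | no _

  venn : 𝕍 → Subset n
  venn u = tabulate λ i → does (u ∈? i)

  lookup-venn : ∀ u i → lookup (venn u) i ≡ does (u ∈? i)
  lookup-venn u = lookup∘tabulate _

  Inhabited : Subset n → Set
  Inhabited σ = Σ (Fin n) λ i → Σ (index (M i)) λ a → venn (elem (M i) a) ≡ σ

  region : Fin n → Subset n → Bool
  region x σ = does (em {Inhabited σ}) ∧ lookup σ x

  region-nonempty : ∀ x σ → region x σ ≡ true → Nonempty σ
  region-nonempty x σ x∈σ = x , lookup⇒[]= x σ (∧-conicalʳ _ _ x∈σ)

  𝔉 : Fin n → PPplus n
  𝔉 x = region x , region-nonempty x

  region-venn : ∀ i a x → region x (venn (elem (M i) a)) ≡ does (elem (M i) a ∈? x)
  region-venn i a x = begin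
    does (em {Inhabited σ}) ∧ lookup σ x ≡⟨ cong (_∧ lookup σ x) (dec-true em (i , a , refl)) ⟩
    lookup σ x                           ≡⟨ lookup-venn _ x ⟩
    does (elem (M i) a ∈? x)             ∎
    where
    open ≡-Reasoning
    σ = venn (elem (M i) a)

  region-pointwise : (op : Bool → Bool → Bool) → op false false ≡ false → ∀ {x y z} →
    (∀ u → does (u ∈? x) ≡ op (does (u ∈? y)) (does (u ∈? z))) →
    ∀ σ → region x σ ≡ op (region y σ) (region z σ)
  region-pointwise op op-false {x} {y} {z} pointwise σ with em {Inhabited σ}
  ... | no _ = sym op-false
  ... | yes (i , a , refl) = begin
    lookup (venn u) x                           ≡⟨ lookup-venn u x ⟩
    does (u ∈? x)                               ≡⟨ pointwise u ⟩
    op (does (u ∈? y)) (does (u ∈? z))          ≡⟨ cong₂ op (lookup-venn u y) (lookup-venn u z) ⟨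
    op (lookup (venn u) y) (lookup (venn u) z)  ∎
    where
    open ≡-Reasoning
    u = elem (M i) a

  region-⊆ : ∀ {x y} → region x ≈ᴾ region y → ∀ u → u ∈𝕍 M x → u ∈𝕍 M y
  region-⊆ {x} {y} x≈y u u∈Mx with ∈-index u∈Mx
  ... | a , u≐v = ∈-respˡ (≐-sym u≐v) (∈?-sound v y v∈?y)
    where
    open ≡-Reasoning
    v = elem (M x) a
    v∈?y : does (v ∈? y) ≡ true
    v∈?y = begin
      does (v ∈? y)     ≡⟨ region-venn x a y ⟨
      region y (venn v) ≡⟨ x≈y (venn v) ⟨
      region x (venn v) ≡⟨ region-venn x a x ⟩
      does (v ∈? x)     ≡⟨ dec-true (v ∈? x) (elem-∈ (M x) a) ⟩
      true              ∎

  region-good : ∀ {L} → SatL M L → GoodL 𝔉 L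
  region-good {x ≔ y ∪ z} sat = region-pointwise _∨_ refl λ u →
    does-⇔ (∈-∪ ⇔-∘ ∈-cong sat) (u ∈? x) (u ∈? y ⊎-dec u ∈? z)
  region-good {x ≔ y ∖ z} sat = region-pointwise (λ b c → b ∧ not c) refl λ u →
    does-⇔ (∈-∖ ⇔-∘ ∈-cong sat) (u ∈? x) (u ∈? y ×-dec ¬? (u ∈? z))
  region-good {x ≠ y} sat x≈y = sat (≐-ext (region-⊆ x≈y) (region-⊆ (sym ∘ x≈y)))

lemma4 : ExcludedMiddle 0ℓ → (n : ℕ) → (Φ : Conj n) → (∀ v → Occurs v Φ) →
    (Satisfiable Φ → Σ (Fin n → PPplus n) λ 𝔉 → All (GoodL 𝔉) Φ)
    × ((Σ (Fin n → PPplus n) λ 𝔉 → All (GoodL 𝔉) Φ) → Satisfiable Φ)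
lemma4 em n Φ _ =
  (λ (M , sat) → VennRegions.𝔉 em M , All.map (VennRegions.region-good em M) sat) ,
  (λ (𝔉 , good) → model 𝔉 , All.map model-sat good)
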